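{- Let $T$ be a concatenation tree (left or right) whose root has label $\alpha$ and change index $c$, and consider the procedure $\mathrm{RCL}(\alpha,c,\ell)$ (with $\ell=1$ for a left concatenation tree and $\ell=0$ for a right one). The sequence output by the call $\mathrm{RCL}(\alpha,c,\ell)$ is generated in $O(1)$-amortized time per symbol provided that (i) at each recursive step, the total work of all calls to $\mathrm{Child}(\alpha',i)$ made for the current node $\alpha'$ is $O((t+1)n)$, where $t$ is the number of children of $\alpha'$, and (ii) the number of periodic nodes of $T$ is less than some constant times the number of aperiodic nodes of $T$.
   Context: Setting: $\Sigma=\{0,\dots,k-1\}$, strings of length $n$. The aperiodic prefix of $\alpha$ is the shortest $\beta$ with $\alpha=\beta^q$; its length is the period; $\alpha$ is periodic if its period is less than $n$, aperiodic otherwise. A concatenation tree is a rooted tree whose nodes carry labels $\alpha\in\Sigma^n$ and change indices in $\{1,\dots,n\}$, where each non-root node's label differs from its parent's label exactly at the node's change index; the children of a node with change index $c'$ are left-children (change index $<c'$) or right-children (change index $>c'$), each ordered by increasing change index, and children with change index $c'$ are all left-children (left concatenation tree) or all right-children (right concatenation tree); no two children of a node share a change index. Function $\mathrm{Child}(\alpha,i)$ returns the symbol $\mathtt{x}$ if $\mathtt{a}_1\cdots\mathtt{a}_{i-1}\mathtt{x}\mathtt{a}_{i+1}\cdots\mathtt{a}_n$ is (the label of) a child of the node labeled $\alpha=\mathtt{a}_1\cdots\mathtt{a}_n$, and $-1$ otherwise. Procedure $\mathrm{RCL}(\alpha=\mathtt{a}_1\cdots\mathtt{a}_n,c,\ell)$: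 for $i=c+\ell,\dots,n$, set $\mathtt{x}=\mathrm{Child}(\alpha,i)$ and if $\mathtt{x}\ne-1$ call $\mathrm{RCL}(\mathtt{a}_1\cdots\mathtt{a}_{i-1}\mathtt{x}\mathtt{a}_{i+1}\cdots\mathtt{a}_n,i,\ell)$; then output $\mathtt{a}_1\cdots\mathtt{a}_p$ where $p$ is the period of $\alpha$; then for $i=1,\dots,c-1+\ell$, set $\mathtt{x}=\mathrm{Child}(\alpha,i)$ and if $\mathtt{x}\ne-1$ call $\mathrm{RCL}(\mathtt{a}_1\cdots\mathtt{a}_{i-1}\mathtt{x}\mathtt{a}_{i+1}\cdots\mathtt{a}_n,i,\ell)$. -}

module Defs where

open import Data.Nat using (ℕ; zero; suc; _+_; _*_; _∸_; _≤_; _<_; _≤?_; _<?_; _/_)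
open import Data.Fin using (Fin; toℕ)
open import Data.Fin.Properties using () renaming (_≟_ to _≟ᶠ_)
open import Data.Vec using (Vec; lookup; _[_]≔_; toList)
open import Data.List using (List; []; _∷_; _++_; length; take; concat; replicate;
  filter; allFin; map; concatMap; upTo)
open import Data.Nat.ListAction using (sum)
open import Data.List.Properties using (≡-dec)
open import Data.Maybe using (Maybe; just; nothing)
open import Data.Product using (Σ; ∃; _×_; _,_)
open import Relation.Nullary using (¬_; yes; no)
open import Relation.Binary.PropositionalEquality using (_≡_; _≢_)

-- Strings over Σ = {0,…,k-1} of length n: Vec (Fin k) n.
-- Positions are Fin n; the 0-based position i stands for the
-- paper's 1-based index suc (toℕ i).

power : ∀ {k} → List (Fin k) → ℕ → List (Fin k)
power β q = concat (replicate q β)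

-- Does the prefix of length p = suc m generate xs, i.e. xs = (take p xs)^(|xs|/p)?
-- (If α = β^q with |β| = p then necessarily β = take p α and q = |α|/p.)
private
  firstRoot : ∀ {k} → List (Fin k) → List ℕ → ℕ → ℕ
  firstRoot xs []            dflt = dflt
  firstRoot xs (m ∷ ms)      dflt with ≡-dec _≟ᶠ_ (power (take (suc m) xs) (length xs / suc m)) xs
  ... | yes _ = suc m
  ... | no  _ = firstRoot xs ms dflt

period : ∀ {k n} → Vec (Fin k) n → ℕ
period {n = n} α = firstRoot (toList α) (upTo n) n

aperiodicPrefix : ∀ {k n} → Vec (Fin k) n → List (Fin k)
aperiodicPrefix α = take (period α) (toList α)

Periodic : ∀ {k n} → Vec (Fin k) n → Set
Periodic {n = n} α = period α < n

-- A node carries a label α ∈ Σⁿ, a change index c, and its children,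
-- indexed by their (distinct) change indices: ch i = just t means that
-- t is the child with change index i (ordering by increasing change
-- index is the order of Fin n).

data CTree (k n : ℕ) : Set where
  node : (α : Vec (Fin k) n) (c : Fin n) (ch : Fin n → Maybe (CTree k n)) → CTree k n

label : ∀ {k n} → CTree k n → Vec (Fin k) n
label (node α _ _) = α

changeIndex : ∀ {k n} → CTree k n → Fin n
changeIndex (node _ c _) = c

data AllNodes {k n} (P : CTree k n → Set) : CTree k n → Set where
  node : ∀ {α c ch} → P (node α c ch)
       → (∀ i t → ch i ≡ just t → AllNodes P t)
       → AllNodes P (node α c ch)

DiffersExactlyAt : ∀ {k n} → Vec (Fin k) n → Vec (Fin k) n → Fin n → Set
DiffersExactlyAt {k} α β i = Σ (Fin k) λ x → (x ≢ lookup α i) × (β ≡ α [ i ]≔ x)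

LocallyValid : ∀ {k n} → CTree k n → Set
LocallyValid (node α c ch) =
  ∀ i t → ch i ≡ just t → (changeIndex t ≡ i) × DiffersExactlyAt α (label t) i

ValidCT : ∀ {k n} → CTree k n → Set
ValidCT = AllNodes LocallyValid

-- Left concatenation tree: children with change index = parent's are
-- left-children, ℓ = 1.  Right concatenation tree: they are right-children,
-- ℓ = 0.  (This only affects the classification of children, hence ℓ.)
data Kind : Set where
  leftTree rightTree : Kind

ℓ-of : Kind → ℕ
ℓ-of leftTree  = 1
ℓ-of rightTree = 0

-- Child(α, i) as determined by the tree: just the child stored at i.
-- number of children t
numChildren : ∀ {k n} → CTree k n → ℕ
numChildren {n = n} (node α c ch) = length (filter (λ i → isJust? (ch i)) (allFin n))
  where
  open import Data.Maybe using (is-just)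
  open import Data.Bool using (T)
  open import Relation.Nullary.Decidable using (T?)
  isJust? = λ (m : Maybe (CTree _ _)) → T? (is-just m)

-- The loops of RCL(α, c, ℓ) (1-based: for i = c+ℓ,…,n then i = 1,…,c-1+ℓ).
-- With 0-based positions: toℕ c + ℓ ≤ toℕ i, resp. toℕ i < toℕ c + ℓ;
-- both lists are in increasing order.

rightLoop : ∀ {n} → Fin n → ℕ → List (Fin n)
rightLoop {n} c ℓ = filter (λ i → toℕ c + ℓ ≤? toℕ i) (allFin n)

leftLoop : ∀ {n} → Fin n → ℕ → List (Fin n)
leftLoop {n} c ℓ = filter (λ i → toℕ i <? toℕ c + ℓ) (allFin n)

childCalls : ∀ {k n} → ℕ → CTree k n → List (Fin n)
childCalls ℓ (node α c ch) = rightLoop c ℓ ++ leftLoop c ℓ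

mutual
  rclOut : ∀ {k n} → ℕ → CTree k n → List (Fin k)
  rclOut ℓ (node α c ch) =
    concatMap (λ i → rclOutM ℓ (ch i)) (rightLoop c ℓ)
    ++ aperiodicPrefix α
    ++ concatMap (λ i → rclOutM ℓ (ch i)) (leftLoop c ℓ)

  rclOutM : ∀ {k n} → ℕ → Maybe (CTree k n) → List (Fin k)
  rclOutM ℓ nothing  = []
  rclOutM ℓ (just t) = rclOut ℓ t

-- Running time of RCL(α, c, ℓ) in the following cost model, where
-- childCost α i is the work of the call Child(α, i):
--   * 1 per call of RCL,
--   * n for determining the period p and outputting a₁⋯a_p,
--   * per loop iteration i: 1 + childCost α i, and if a child is found,
--     n for building the child's label plus the cost of the recursive call.
mutual
  rclCost : ∀ {k n} → (Vec (Fin k) n → Fin n → ℕ) → ℕ → CTree k n → ℕ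
  rclCost {n = n} cc ℓ (node α c ch) =
    1 + n + sum (map (λ i → 1 + cc α i + rclCostM cc ℓ (ch i)) (rightLoop c ℓ ++ leftLoop c ℓ))

  rclCostM : ∀ {k n} → (Vec (Fin k) n → Fin n → ℕ) → ℕ → Maybe (CTree k n) → ℕ
  rclCostM         cc ℓ nothing  = 0
  rclCostM {n = n} cc ℓ (just t) = n + rclCost cc ℓ t

mutual
  countNodes : ∀ {k n} → (Vec (Fin k) n → ℕ) → CTree k n → ℕ
  countNodes {n = n} f (node α c ch) = f α + sum (map (λ i → countNodesM f (ch i)) (allFin n))

  countNodesM : ∀ {k n} → (Vec (Fin k) n → ℕ) → Maybe (CTree k n) → ℕ
  countNodesM f nothing  = 0
  countNodesM f (just t) = countNodes f t

private
  periodicIndicator : ∀ {k n} → Vec (Fin k) n → ℕ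
  periodicIndicator {n = n} α with period α <? n
  ... | yes _ = 1
  ... | no  _ = 0

  aperiodicIndicator : ∀ {k n} → Vec (Fin k) n → ℕ
  aperiodicIndicator {n = n} α with period α <? n
  ... | yes _ = 0
  ... | no  _ = 1

periodicNodes : ∀ {k n} → CTree k n → ℕ
periodicNodes = countNodes periodicIndicator

aperiodicNodes : ∀ {k n} → CTree k n → ℕ
aperiodicNodes = countNodes aperiodicIndicator

ChildWorkBound : ∀ {k n} → ℕ → (Vec (Fin k) n → Fin n → ℕ) → ℕ → CTree k n → Set
ChildWorkBound {n = n} C₁ cc ℓ t =
  sum (map (cc (label t)) (childCalls ℓ t)) ≤ C₁ * (numChildren t + 1) * n

{-# OPTIONS --safe #-}
-- Charge all work of RCL to the nodes of T.  A node with t children pays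
-- O(n) for its loops and output and O((t+1)n) for its Child calls (i); a child
-- pays O(n) more for the construction of its label.  Summing, the cost is
-- O(n |T|).  By (ii), |T| = periodic + aperiodic < (C₂ + 1) · aperiodic, and
-- every aperiodic node outputs its whole label, so the output has at least
-- n · aperiodic symbols.
module Submission where

open import Defs
open import Data.Nat using (ℕ; suc; >-nonZero⁻¹; _≤_; _<_; _*_; _+_; _≤?_; _<?_; z≤n; _⊓_)
open import Data.Nat.Properties
open import Data.Nat.ListAction using (sum)
open import Data.Nat.ListAction.Properties using (sum-++; sum-↭)
open import Data.Nat.Tactic.RingSolver using (solve-∀)
open import Data.Fin using (Fin; toℕ)
open import Data.Fin.Properties using (nonZeroIndex)
open import Data.Vec using (Vec; toList)
open import Data.Vec.Properties using (length-toList)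
open import Data.List using (List; []; _∷_; _++_; length; map; filter; allFin; concatMap)
open import Data.List.Properties using (map-++; map-cong; length-++; length-take; length-tabulate; filter-≐)
open import Data.List.Relation.Binary.Permutation.Propositional using (_↭_; prep; ↭-refl; ↭-trans)
open import Data.List.Relation.Binary.Permutation.Propositional.Properties using (shift; map⁺)
open import Data.Maybe using (Maybe; just; nothing; is-just)
open import Data.Product using (∃-syntax; _,_)
open import Function using (_∘_)
open import Relation.Nullary using (yes; no)
open import Relation.Nullary.Decidable using (T?)
open import Relation.Unary using (Pred; Decidable)
open import Relation.Unary.Properties using (∁?)
open import Relation.Binary.PropositionalEquality

module _ {A : Set} where

  sum-map-+ : (f g : A → ℕ) (xs : List A) →
    sum (map (λ x → f x + g x) xs) ≡ sum (map f xs) + sum (map g xs)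
  sum-map-+ f g [] = refl
  sum-map-+ f g (x ∷ xs) rewrite sum-map-+ f g xs = interchange (f x) (g x) _ _
    where
    interchange : ∀ a b c d → (a + b) + (c + d) ≡ (a + c) + (b + d)
    interchange = solve-∀

  sum-map-*ˡ : (m : ℕ) (f : A → ℕ) (xs : List A) →
    sum (map (λ x → m * f x) xs) ≡ m * sum (map f xs)
  sum-map-*ˡ m f [] = sym (*-zeroʳ m)
  sum-map-*ˡ m f (x ∷ xs) rewrite sum-map-*ˡ m f xs = sym (*-distribˡ-+ m (f x) _)

  sum-map-const : (m : ℕ) (xs : List A) → sum (map (λ _ → m) xs) ≡ length xs * m
  sum-map-const m [] = refl
  sum-map-const m (x ∷ xs) = cong (m +_) (sum-map-const m xs)

  sum-map-zero : (xs : List A) → sum (map (λ _ → 0) xs) ≡ 0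
  sum-map-zero xs = trans (sum-map-const 0 xs) (*-zeroʳ (length xs))

  sum-map-mono : {f g : A → ℕ} → (∀ x → f x ≤ g x) → (xs : List A) →
    sum (map f xs) ≤ sum (map g xs)
  sum-map-mono f≤g [] = z≤n
  sum-map-mono f≤g (x ∷ xs) = +-mono-≤ (f≤g x) (sum-map-mono f≤g xs)

  sum-map-++ : (f : A → ℕ) (xs ys : List A) →
    sum (map f (xs ++ ys)) ≡ sum (map f xs) + sum (map f ys)
  sum-map-++ f xs ys = trans (cong sum (map-++ f xs ys)) (sum-++ (map f xs) _)

  sum-map-concatMap : {B : Set} (f : A → ℕ) (g : B → List A) (xs : List B) →
    sum (map f (concatMap g xs)) ≡ sum (map (λ x → sum (map f (g x))) xs)
  sum-map-concatMap f g [] = refl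
  sum-map-concatMap f g (x ∷ xs) = begin
    sum (map f (g x ++ concatMap g xs))
      ≡⟨ sum-map-++ f (g x) _ ⟩
    sum (map f (g x)) + sum (map f (concatMap g xs))
      ≡⟨ cong (sum (map f (g x)) +_) (sum-map-concatMap f g xs) ⟩
    sum (map (λ y → sum (map f (g y))) (x ∷ xs)) ∎
    where open ≡-Reasoning

  length-concatMap : {B : Set} (g : A → List B) (xs : List A) →
    length (concatMap g xs) ≡ sum (map (length ∘ g) xs)
  length-concatMap g [] = refl
  length-concatMap g (x ∷ xs) =
    trans (length-++ (g x)) (cong (length (g x) +_) (length-concatMap g xs))

  filter-++-filter-∁ : ∀ {p} {P : Pred A p} (P? : Decidable P) (xs : List A) →
    filter P? xs ++ filter (∁? P?) xs ↭ xs
  filter-++-filter-∁ P? [] = ↭-refl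
  filter-++-filter-∁ P? (x ∷ xs) with P? x
  ... | yes _ = prep x (filter-++-filter-∁ P? xs)
  ... | no  _ = ↭-trans (shift x (filter P? xs) _) (prep x (filter-++-filter-∁ P? xs))

  justCount : Maybe A → ℕ
  justCount nothing  = 0
  justCount (just _) = 1

  length-filter-is-just : {B : Set} (m : B → Maybe A) (xs : List B) →
    length (filter (λ x → T? (is-just (m x))) xs) ≡ sum (map (justCount ∘ m) xs)
  length-filter-is-just m [] = refl
  length-filter-is-just m (x ∷ xs) with m x
  ... | nothing = length-filter-is-just m xs
  ... | just _  = cong suc (length-filter-is-just m xs)

module _ {k n : ℕ} where

  leaf : Vec (Fin k) n → Fin n → CTree k n
  leaf α c = node α c (λ _ → nothing)

  size : CTree k n → ℕ
  size = countNodes (λ _ → 1)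

  mutual
    labels : CTree k n → List (Vec (Fin k) n)
    labels (node α c ch) = α ∷ concatMap (λ i → labelsM (ch i)) (allFin n)

    labelsM : Maybe (CTree k n) → List (Vec (Fin k) n)
    labelsM nothing  = []
    labelsM (just t) = labels t

  mutual
    countNodes≡sum-labels : (f : Vec (Fin k) n → ℕ) (T : CTree k n) →
      countNodes f T ≡ sum (map f (labels T))
    countNodes≡sum-labels f (node α c ch) = cong (f α +_) (begin
      sum (map (λ i → countNodesM f (ch i)) (allFin n))
        ≡⟨ cong sum (map-cong (λ i → countNodesM≡sum-labelsM f (ch i)) (allFin n)) ⟩
      sum (map (λ i → sum (map f (labelsM (ch i)))) (allFin n))
        ≡⟨ sum-map-concatMap f (λ i → labelsM (ch i)) (allFin n) ⟨
      sum (map f (concatMap (λ i → labelsM (ch i)) (allFin n))) ∎)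
      where open ≡-Reasoning

    countNodesM≡sum-labelsM : (f : Vec (Fin k) n → ℕ) (m : Maybe (CTree k n)) →
      countNodesM f m ≡ sum (map f (labelsM m))
    countNodesM≡sum-labelsM f nothing  = refl
    countNodesM≡sum-labelsM f (just t) = countNodes≡sum-labels f t

  countNodes-leaf : (f : Vec (Fin k) n → ℕ) (α : Vec (Fin k) n) (c : Fin n) →
    countNodes f (leaf α c) ≡ f α
  countNodes-leaf f α c = trans (cong (f α +_) (sum-map-zero (allFin n))) (+-identityʳ (f α))

  countNodes-+ : (f g : Vec (Fin k) n → ℕ) (T : CTree k n) →
    countNodes f T + countNodes g T ≡ countNodes (λ α → f α + g α) T
  countNodes-+ f g T = begin
    countNodes f T + countNodes g T
      ≡⟨ cong₂ _+_ (countNodes≡sum-labels f T) (countNodes≡sum-labels g T) ⟩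
    sum (map f (labels T)) + sum (map g (labels T))
      ≡⟨ sum-map-+ f g (labels T) ⟨
    sum (map (λ α → f α + g α) (labels T))
      ≡⟨ countNodes≡sum-labels _ T ⟨
    countNodes (λ α → f α + g α) T ∎
    where open ≡-Reasoning

  countNodes-*ˡ : (m : ℕ) (f : Vec (Fin k) n → ℕ) (T : CTree k n) →
    m * countNodes f T ≡ countNodes (λ α → m * f α) T
  countNodes-*ˡ m f T = begin
    m * countNodes f T                  ≡⟨ cong (m *_) (countNodes≡sum-labels f T) ⟩
    m * sum (map f (labels T))          ≡⟨ sum-map-*ˡ m f (labels T) ⟨
    sum (map (λ α → m * f α) (labels T)) ≡⟨ countNodes≡sum-labels _ T ⟨
    countNodes (λ α → m * f α) T        ∎
    where open ≡-Reasoning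

  countNodes-mono : {f g : Vec (Fin k) n → ℕ} → (∀ α → f α ≤ g α) → (T : CTree k n) →
    countNodes f T ≤ countNodes g T
  countNodes-mono {f} {g} f≤g T = begin
    countNodes f T          ≡⟨ countNodes≡sum-labels f T ⟩
    sum (map f (labels T))  ≤⟨ sum-map-mono f≤g (labels T) ⟩
    sum (map g (labels T))  ≡⟨ countNodes≡sum-labels g T ⟨
    countNodes g T          ∎
    where open ≤-Reasoning

  countNodes-cong : {f g : Vec (Fin k) n → ℕ} → (∀ α → f α ≡ g α) → (T : CTree k n) →
    countNodes f T ≡ countNodes g T
  countNodes-cong f≡g T =
    ≤-antisym (countNodes-mono (≤-reflexive ∘ f≡g) T) (countNodes-mono (≤-reflexive ∘ sym ∘ f≡g) T)

  countNodes-complementary : (f g : Vec (Fin k) n → ℕ) (c : Fin n) →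
    (∀ α → countNodes f (leaf α c) + countNodes g (leaf α c) ≡ 1) →
    (T : CTree k n) → countNodes f T + countNodes g T ≡ size T
  countNodes-complementary f g c f+g≡1 T = trans (countNodes-+ f g T) (countNodes-cong pointwise T)
    where
    pointwise : ∀ α → f α + g α ≡ 1
    pointwise α = trans (sym (cong₂ _+_ (countNodes-leaf f α c) (countNodes-leaf g α c))) (f+g≡1 α)

  loops↭allFin : (c : Fin n) (ℓ : ℕ) → rightLoop c ℓ ++ leftLoop c ℓ ↭ allFin n
  loops↭allFin c ℓ =
    subst (λ L → rightLoop c ℓ ++ L ↭ allFin n)
      (filter-≐ (∁? startsRight?) (λ i → toℕ i <? toℕ c + ℓ) (≰⇒> , <⇒≱) (allFin n))
      (filter-++-filter-∁ startsRight? (allFin n))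
    where
    startsRight? = λ (i : Fin n) → toℕ c + ℓ ≤? toℕ i

  sum-map-loops : (f : Fin n → ℕ) (c : Fin n) (ℓ : ℕ) →
    sum (map f (rightLoop c ℓ ++ leftLoop c ℓ)) ≡ sum (map f (allFin n))
  sum-map-loops f c ℓ = sum-↭ (map⁺ f (loops↭allFin c ℓ))

  numChildren-node : (α : Vec (Fin k) n) (c : Fin n) (ch : Fin n → Maybe (CTree k n)) →
    numChildren (node α c ch) ≡ sum (map (justCount ∘ ch) (allFin n))
  numChildren-node α c ch = length-filter-is-just ch (allFin n)

  mutual
    length-rclOut : (ℓ : ℕ) (T : CTree k n) →
      length (rclOut ℓ T) ≡ countNodes (length ∘ aperiodicPrefix) T
    length-rclOut ℓ (node α c ch) = begin
      length (out (rightLoop c ℓ) ++ pre ++ out (leftLoop c ℓ))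
        ≡⟨ length-++ (out (rightLoop c ℓ)) ⟩
      length (out (rightLoop c ℓ)) + length (pre ++ out (leftLoop c ℓ))
        ≡⟨ cong (length (out (rightLoop c ℓ)) +_) (length-++ pre) ⟩
      length (out (rightLoop c ℓ)) + (length pre + length (out (leftLoop c ℓ)))
        ≡⟨ cong₂ (λ r l → r + (length pre + l))
                 (length-concatMap _ (rightLoop c ℓ)) (length-concatMap _ (leftLoop c ℓ)) ⟩
      sum (map R (rightLoop c ℓ)) + (length pre + sum (map R (leftLoop c ℓ)))
        ≡⟨ +-comm-middle (sum (map R (rightLoop c ℓ))) (length pre) _ ⟩
      length pre + (sum (map R (rightLoop c ℓ)) + sum (map R (leftLoop c ℓ)))
        ≡⟨ cong (length pre +_) (trans (sym (sum-map-++ R (rightLoop c ℓ) _)) (sum-map-loops R c ℓ)) ⟩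
      length pre + sum (map R (allFin n))
        ≡⟨ cong (λ s → length pre + sum s) (map-cong (λ i → length-rclOutM ℓ (ch i)) (allFin n)) ⟩
      countNodes (length ∘ aperiodicPrefix) (node α c ch) ∎
      where
      open ≡-Reasoning
      pre = aperiodicPrefix α
      out : List (Fin n) → List (Fin k)
      out = concatMap (λ i → rclOutM ℓ (ch i))
      R : Fin n → ℕ
      R i = length (rclOutM ℓ (ch i))
      +-comm-middle : ∀ a b c → a + (b + c) ≡ b + (a + c)
      +-comm-middle = solve-∀

    length-rclOutM : (ℓ : ℕ) (m : Maybe (CTree k n)) →
      length (rclOutM ℓ m) ≡ countNodesM (length ∘ aperiodicPrefix) m
    length-rclOutM ℓ nothing  = refl
    length-rclOutM ℓ (just t) = length-rclOut ℓ t

  n*countNodes≤length-rclOut : (f : Vec (Fin k) n → ℕ) (c : Fin n) →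
    (∀ α → n * countNodes f (leaf α c) ≤ length (aperiodicPrefix α)) →
    (ℓ : ℕ) (T : CTree k n) → n * countNodes f T ≤ length (rclOut ℓ T)
  n*countNodes≤length-rclOut f c n*f≤ ℓ T = begin
    n * countNodes f T                       ≡⟨ countNodes-*ˡ n f T ⟩
    countNodes (λ α → n * f α) T             ≤⟨ countNodes-mono pointwise T ⟩
    countNodes (length ∘ aperiodicPrefix) T  ≡⟨ length-rclOut ℓ T ⟨
    length (rclOut ℓ T)                      ∎
    where
    open ≤-Reasoning
    pointwise : ∀ α → n * f α ≤ length (aperiodicPrefix α)
    pointwise α = subst (λ a → n * a ≤ length (aperiodicPrefix α)) (countNodes-leaf f α c) (n*f≤ α)

  rclCost-node : (cc : Vec (Fin k) n → Fin n → ℕ) (ℓ : ℕ)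
    (α : Vec (Fin k) n) (c : Fin n) (ch : Fin n → Maybe (CTree k n)) →
    rclCost cc ℓ (node α c ch)
      ≡ 1 + n + (n + sum (map (cc α) (childCalls ℓ (node α c ch)))
                  + sum (map (λ i → rclCostM cc ℓ (ch i)) (allFin n)))
  rclCost-node cc ℓ α c ch = cong (1 + n +_) (begin
    sum (map (λ i → 1 + cc α i + sub i) L)
      ≡⟨ sum-map-+ (λ i → 1 + cc α i) sub L ⟩
    sum (map (λ i → 1 + cc α i) L) + sum (map sub L)
      ≡⟨ cong₂ _+_ (sum-map-+ (λ _ → 1) (cc α) L) (sum-map-loops sub c ℓ) ⟩
    sum (map (λ _ → 1) L) + sum (map (cc α) L) + sum (map sub (allFin n))
      ≡⟨ cong (λ z → z + sum (map (cc α) L) + sum (map sub (allFin n))) iterations ⟩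
    n + sum (map (cc α) L) + sum (map sub (allFin n)) ∎)
    where
    open ≡-Reasoning
    L = rightLoop c ℓ ++ leftLoop c ℓ
    sub : Fin n → ℕ
    sub i = rclCostM cc ℓ (ch i)
    iterations : sum (map (λ _ → 1) L) ≡ n
    iterations = begin
      sum (map (λ _ → 1) L)              ≡⟨ sum-map-loops (λ _ → 1) c ℓ ⟩
      sum (map (λ _ → 1) (allFin n))     ≡⟨ sum-map-const 1 (allFin n) ⟩
      length (allFin n) * 1              ≡⟨ *-identityʳ _ ⟩
      length (allFin n)                  ≡⟨ length-tabulate (λ i → i) ⟩
      n                                  ∎

cost-step : ∀ n C₁ W S t N → 1 ≤ n → W ≤ C₁ * (t + 1) * n →
  S + C₁ * n * t ≤ (4 + 2 * C₁) * n * N →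
  n + (1 + n + (n + W + S)) + C₁ * n ≤ (4 + 2 * C₁) * n * (1 + N)
cost-step n C₁ W S t N 1≤n work children = begin
  n + (1 + n + (n + W + S)) + C₁ * n
    ≡⟨ e₁ n C₁ W S ⟩
  (1 + 3 * n + C₁ * n) + W + S
    ≤⟨ +-monoˡ-≤ S (+-monoʳ-≤ (1 + 3 * n + C₁ * n) work) ⟩
  (1 + 3 * n + C₁ * n) + C₁ * (t + 1) * n + S
    ≡⟨ e₂ n C₁ t S ⟩
  (1 + 3 * n + 2 * C₁ * n) + (S + C₁ * n * t)
    ≤⟨ +-mono-≤ (+-monoˡ-≤ (2 * C₁ * n) (+-monoˡ-≤ (3 * n) 1≤n)) children ⟩
  (n + 3 * n + 2 * C₁ * n) + (4 + 2 * C₁) * n * N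
    ≡⟨ e₃ n C₁ N ⟩
  (4 + 2 * C₁) * n * (1 + N) ∎
  where
  open ≤-Reasoning
  e₁ : ∀ n C₁ W S → n + (1 + n + (n + W + S)) + C₁ * n ≡ (1 + 3 * n + C₁ * n) + W + S
  e₁ = solve-∀
  e₂ : ∀ n C₁ t S → (1 + 3 * n + C₁ * n) + C₁ * (t + 1) * n + S
                     ≡ (1 + 3 * n + 2 * C₁ * n) + (S + C₁ * n * t)
  e₂ = solve-∀
  e₃ : ∀ n C₁ N → (n + 3 * n + 2 * C₁ * n) + (4 + 2 * C₁) * n * N ≡ (4 + 2 * C₁) * n * (1 + N)
  e₃ = solve-∀

module _ {k n : ℕ} (C₁ : ℕ) (cc : Vec (Fin k) n → Fin n → ℕ) (ℓ : ℕ) where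

  -- The slack n + C₁ n on the left is what the parent is charged for this node:
  -- building its label, and its share of the parent's Child work.
  mutual
    rclCost-bound : (T : CTree k n) → AllNodes (ChildWorkBound C₁ cc ℓ) T →
      n + rclCost cc ℓ T + C₁ * n ≤ (4 + 2 * C₁) * n * size T
    rclCost-bound (node α c ch) (node work below) =
      subst (λ x → n + x + C₁ * n ≤ (4 + 2 * C₁) * n * (1 + N))
        (sym (rclCost-node cc ℓ α c ch))
        (cost-step n C₁ _ S kids N (>-nonZero⁻¹ n {{nonZeroIndex c}})
          (subst (λ u → _ ≤ C₁ * (u + 1) * n) (numChildren-node α c ch) work)
          subtrees)
      where
      S = sum (map (λ i → rclCostM cc ℓ (ch i)) (allFin n))
      kids = sum (map (justCount ∘ ch) (allFin n))
      N = sum (map (λ i → countNodesM (λ _ → 1) (ch i)) (allFin n))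
      subtrees : S + C₁ * n * kids ≤ (4 + 2 * C₁) * n * N
      subtrees = begin
        S + C₁ * n * kids
          ≡⟨ cong (S +_) (sum-map-*ˡ (C₁ * n) (justCount ∘ ch) (allFin n)) ⟨
        S + sum (map (λ i → C₁ * n * justCount (ch i)) (allFin n))
          ≡⟨ sum-map-+ (λ i → rclCostM cc ℓ (ch i)) _ (allFin n) ⟨
        sum (map (λ i → rclCostM cc ℓ (ch i) + C₁ * n * justCount (ch i)) (allFin n))
          ≤⟨ sum-map-mono (λ i → rclCostM-bound (ch i) (below i)) (allFin n) ⟩
        sum (map (λ i → (4 + 2 * C₁) * n * countNodesM (λ _ → 1) (ch i)) (allFin n))
          ≡⟨ sum-map-*ˡ ((4 + 2 * C₁) * n) _ (allFin n) ⟩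
        (4 + 2 * C₁) * n * N ∎
        where open ≤-Reasoning

    rclCostM-bound : (m : Maybe (CTree k n)) →
      (∀ t → m ≡ just t → AllNodes (ChildWorkBound C₁ cc ℓ) t) →
      rclCostM cc ℓ m + C₁ * n * justCount m ≤ (4 + 2 * C₁) * n * countNodesM (λ _ → 1) m
    rclCostM-bound nothing  _     =
      ≤-reflexive (trans (*-zeroʳ (C₁ * n)) (sym (*-zeroʳ ((4 + 2 * C₁) * n))))
    rclCostM-bound (just t) below =
      subst (λ x → n + rclCost cc ℓ t + x ≤ (4 + 2 * C₁) * n * size t)
        (sym (*-identityʳ (C₁ * n))) (rclCost-bound t (below t refl))

module _ {k n : ℕ} where

  -- The counting functions behind periodicNodes and aperiodicNodes are private to
  -- Defs; their values at α are reached through the one-node tree leaf α c.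
  periodicNodes+aperiodicNodes-leaf : (α : Vec (Fin k) n) (c : Fin n) →
    periodicNodes (leaf α c) + aperiodicNodes (leaf α c) ≡ 1
  periodicNodes+aperiodicNodes-leaf α c with period α <? n
  ... | yes _ = cong (λ z → suc (z + z)) (sum-map-zero (allFin n))
  ... | no  _ = cong (λ z → z + suc z) (sum-map-zero (allFin n))

  n*aperiodicNodes-leaf≤ : (α : Vec (Fin k) n) (c : Fin n) →
    n * aperiodicNodes (leaf α c) ≤ length (aperiodicPrefix α)
  n*aperiodicNodes-leaf≤ α c with period α <? n
  ... | yes _ = ≤-trans (≤-reflexive (trans (cong (n *_) (sum-map-zero (allFin n))) (*-zeroʳ n))) z≤n
  ... | no p≮n = ≤-reflexive (begin
    n * (1 + sum (map (λ _ → 0) (allFin n)))  ≡⟨ cong (λ z → n * suc z) (sum-map-zero (allFin n)) ⟩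
    n * 1                                     ≡⟨ *-identityʳ n ⟩
    n                                         ≡⟨ m≥n⇒m⊓n≡n (≮⇒≥ p≮n) ⟨
    period α ⊓ n                              ≡⟨ cong (period α ⊓_) (length-toList α) ⟨
    period α ⊓ length (toList α)              ≡⟨ length-take (period α) (toList α) ⟨
    length (aperiodicPrefix α)                ∎)
    where open ≡-Reasoning

  rclCost≤length-rclOut : (C₁ C₂ ℓ : ℕ) (T : CTree k n) (cc : Vec (Fin k) n → Fin n → ℕ) →
    AllNodes (ChildWorkBound C₁ cc ℓ) T →
    periodicNodes T < C₂ * aperiodicNodes T →
    rclCost cc ℓ T ≤ (4 + 2 * C₁) * (C₂ + 1) * length (rclOut ℓ T)
  rclCost≤length-rclOut C₁ C₂ ℓ T cc work fewPeriodic = begin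
    rclCost cc ℓ T
      ≤⟨ ≤-trans (m≤n+m _ n) (m≤m+n _ (C₁ * n)) ⟩
    n + rclCost cc ℓ T + C₁ * n
      ≤⟨ rclCost-bound C₁ cc ℓ T work ⟩
    (4 + 2 * C₁) * n * size T
      ≡⟨ cong ((4 + 2 * C₁) * n *_) (countNodes-complementary _ _ c
            (λ α → periodicNodes+aperiodicNodes-leaf α c) T) ⟨
    (4 + 2 * C₁) * n * (periodicNodes T + aperiodicNodes T)
      ≤⟨ *-monoʳ-≤ ((4 + 2 * C₁) * n) (+-monoˡ-≤ (aperiodicNodes T) (<⇒≤ fewPeriodic)) ⟩
    (4 + 2 * C₁) * n * (C₂ * aperiodicNodes T + aperiodicNodes T)
      ≡⟨ regroup C₁ C₂ n (aperiodicNodes T) ⟩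
    (4 + 2 * C₁) * (C₂ + 1) * (n * aperiodicNodes T)
      ≤⟨ *-monoʳ-≤ ((4 + 2 * C₁) * (C₂ + 1))
           (n*countNodes≤length-rclOut _ c (λ α → n*aperiodicNodes-leaf≤ α c) ℓ T) ⟩
    (4 + 2 * C₁) * (C₂ + 1) * length (rclOut ℓ T) ∎
    where
    open ≤-Reasoning
    c = changeIndex T
    regroup : ∀ C₁ C₂ n a → (4 + 2 * C₁) * n * (C₂ * a + a) ≡ (4 + 2 * C₁) * (C₂ + 1) * (n * a)
    regroup = solve-∀

theorem3 : (C₁ C₂ : ℕ) → ∃[ C ] (∀ {k n} (kind : Kind) (T : CTree k n)
             (childCost : Vec (Fin k) n → Fin n → ℕ) →
             ValidCT T →
             AllNodes (ChildWorkBound C₁ childCost (ℓ-of kind)) T →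
             periodicNodes T < C₂ * aperiodicNodes T →
             rclCost childCost (ℓ-of kind) T ≤ C * length (rclOut (ℓ-of kind) T))
theorem3 C₁ C₂ =
  (4 + 2 * C₁) * (C₂ + 1) , λ kind T childCost _ → rclCost≤length-rclOut C₁ C₂ (ℓ-of kind) T childCost
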